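{- Let $\mathcal H\subseteq 2^V$ be a hypergraph satisfying the following three properties: (A1) $\mathcal H$ is minimal transversal-free; (D1) for every pair of hyperedges $H,H'\in\mathcal H$ there is a chain $H_0,H_1,\dots,H_p$ in $\mathcal H$ with $H_0=H$, $H_p=H'$, and $H_i\subseteq H\cup H'$ for $i=1,\dots,p$; (D2) for every position $x\in\mathbb Z_{\ge0}^V$ with $m(x)>0$ there is a hyperedge $H\in\mathcal H$ such that $h_{\mathcal H}(x-\chi(H))=h_{\mathcal H}(x)-1$ and $m(x-\chi(H))=m(x)-1$. Then $\mathcal H$ is JM.
   Context: Let $V=\{1,\dots,n\}$. A hypergraph is a family $\mathcal H\subseteq 2^V$ with $\mathcal H\neq\emptyset$, $\emptyset\notin\mathcal H$, $V=\bigcup_{H\in\mathcal H}H$. The game $NIM_{\mathcal H}$ is played on positions $x\in\mathbb{Z}_{\ge 0}^V$; a move ($H$-move) $x\to x'$ chooses $H\in\mathcal H$ and goes to any $x'\in\mathbb Z_{\ge0}^V$ with $x'_i<x_i$ for $i\in H$ and $x'_i=x_i$ for $i\notin H$. Players alternate; the player who cannot move loses. The Sprague–Grundy function is $\mathcal G_{\mathcal H}(x)=\mathrm{mex}\{\mathcal G_{\mathcal H}(x') : x\to x' \text{ a move}\}$ ($\mathrm{mex}(S)$ = least nonnegative integer not in $S$). The height $h_{\mathcal H}(x)$ is the maximum number of consecutive moves possible from $x$. With $e$ the all-ones vector, $m(x)=\min_{i}x_i$, $y_{\mathcal H}(x)=h_{\mathcal H}(x-m(x)e)+1$, $v_{\mathcal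 H}(x)=\binom{y_{\mathcal H}(x)}{2}+\big((m(x)-\binom{y_{\mathcal H}(x)}{2}-1)\bmod y_{\mathcal H}(x)\big)$ (residue in $\{0,\dots,y_{\mathcal H}(x)-1\}$), and $f_{\mathcal H}(x)=h_{\mathcal H}(x)$ if $m(x)\le\binom{y_{\mathcal H}(x)}{2}$, else $f_{\mathcal H}(x)=v_{\mathcal H}(x)$. $\mathcal H$ is JM if $\mathcal G_{\mathcal H}=f_{\mathcal H}$ on $\mathbb Z_{\ge0}^V$. $\chi(H)$ is the characteristic vector of $H$. A set $T$ is a transversal of $\mathcal H$ if it meets every hyperedge; $\mathcal H$ is transversal-free if no hyperedge is a transversal of $\mathcal H$; with $\mathcal H_S=\{H\in\mathcal H:H\subseteq S\}$, $\mathcal H$ is minimal transversal-free if it is transversal-free and for every $S\subsetneq V$ with $\mathcal H_S\neq\emptyset$, $\mathcal H_S$ is not transversal-free. A sequence $H_0,\dots,H_p$ of hyperedges ($p\ge0$) is a chain if $H_{k+1}\cap H_k\neq\emptyset$ and $|H_{k+1}\setminus H_k|\le1$ for $k=0,\dots,p-1$. -}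

module Defs where

open import Data.Nat using (ℕ; zero; suc; _+_; _∸_; _≤_; _<_; _≤ᵇ_; _⊓_; _%_)
open import Data.Nat.Combinatorics using (_C_)
open import Data.Bool using (Bool; true; false; if_then_else_)
open import Data.Fin using (Fin) renaming (zero to fzero; suc to fsuc)
open import Data.Fin.Subset using (Subset; _∈_; _∉_; _⊆_; _⊂_; _∩_; _∪_; _─_; ∣_∣; Nonempty; ⊥; ⊤)
open import Data.Vec using (lookup)
open import Data.Product using (Σ; ∃; _×_; _,_)
open import Relation.Binary.PropositionalEquality using (_≡_; _≢_)
open import Relation.Nullary using (¬_)

Family : ℕ → Set₁
Family n = Subset n → Set

IsHypergraph : ∀ {n} → Family n → Set
IsHypergraph {n} ℋ =
  (∃ λ E → ℋ E) × (¬ ℋ ⊥) × (∀ (i : Fin n) → ∃ λ E → ℋ E × i ∈ E)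

Pos : ℕ → Set
Pos n = Fin n → ℕ

Move : ∀ {n} → Family n → Pos n → Pos n → Set
Move {n} ℋ x x' = ∃ λ E → ℋ E ×
  ((∀ (i : Fin n) → i ∈ E → x' i < x i) × (∀ (i : Fin n) → i ∉ E → x' i ≡ x i))

IsMex : (ℕ → Set) → ℕ → Set
IsMex S k = ¬ S k × (∀ j → j < k → S j)

IsSG : ∀ {n} → Family n → (Pos n → ℕ) → Set
IsSG ℋ g = ∀ x → IsMex (λ j → ∃ λ x' → Move ℋ x x' × g x' ≡ j) (g x)

data Play {n} (ℋ : Family n) : Pos n → ℕ → Set where
  stop : ∀ {x} → Play ℋ x 0
  step : ∀ {x x' k} → Move ℋ x x' → Play ℋ x' k → Play ℋ x (suc k)

IsHeight : ∀ {n} → Family n → (Pos n → ℕ) → Set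
IsHeight ℋ h = ∀ x → Play ℋ x (h x) × (∀ k → Play ℋ x k → k ≤ h x)

-- m(x) = min_i x_i  (value 0 for n = 0 is an irrelevant convention).
minPos : ∀ {n} → Pos n → ℕ
minPos {zero} x = 0
minPos {suc zero} x = x fzero
minPos {suc (suc n)} x = x fzero ⊓ minPos (λ i → x (fsuc i))

subMin : ∀ {n} → Pos n → Pos n
subMin x i = x i ∸ minPos x

subχ : ∀ {n} → Pos n → Subset n → Pos n
subχ x E i = if lookup E i then x i ∸ 1 else x i

fJM : ∀ {n} → (Pos n → ℕ) → Pos n → ℕ
fJM h x =
  let m = minPos x
      y = suc (h (subMin x))
      c = y C 2
  in if m ≤ᵇ c then h x else c + ((m ∸ c ∸ 1) % y)

-- JM: the Sprague–Grundy function equals f_ℋ.  (G and h are characterised by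
-- their defining recursions / maximality; they are unique, so we quantify over them.)
JM : ∀ {n} → Family n → Set
JM ℋ = ∀ (h g : Pos _ → ℕ) → IsHeight ℋ h → IsSG ℋ g → ∀ x → g x ≡ fJM h x

Transversal : ∀ {n} → Family n → Subset n → Set
Transversal ℋ T = ∀ E → ℋ E → Nonempty (T ∩ E)

TransversalFree : ∀ {n} → Family n → Set
TransversalFree ℋ = ∀ E → ℋ E → ¬ Transversal ℋ E

Restrict : ∀ {n} → Family n → Subset n → Family n
Restrict ℋ S E = ℋ E × E ⊆ S

MinimalTransversalFree : ∀ {n} → Family n → Set
MinimalTransversalFree ℋ = TransversalFree ℋ ×
  (∀ S → S ⊂ ⊤ → (∃ λ E → Restrict ℋ S E) → ¬ TransversalFree (Restrict ℋ S))

D1 : ∀ {n} → Family n → Set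
D1 ℋ = ∀ H H' → ℋ H → ℋ H' → ∃ λ (p : ℕ) → ∃ λ (c : ℕ → Subset _) →
  (∀ k → k ≤ p → ℋ (c k)) × c 0 ≡ H × c p ≡ H' ×
  (∀ k → k < p → Nonempty (c (suc k) ∩ c k) × ∣ c (suc k) ─ c k ∣ ≤ 1) ×
  (∀ k → 1 ≤ k → k ≤ p → c k ⊆ (H ∪ H'))

D2 : ∀ {n} → Family n → Set
D2 ℋ = ∀ (h : Pos _ → ℕ) → IsHeight ℋ h → ∀ x → 0 < minPos x →
  ∃ λ E → ℋ E × h (subχ x E) ≡ h x ∸ 1 × minPos (subχ x E) ≡ minPos x ∸ 1

module Submission where

-- Since G is characterised by the mex recursion, it suffices (sg-unique,
-- induction on the height h) to show
--   (a) f x' ≠ f x for every move x → x'                     (f-separated),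
--   (b) every j < f x is the value f x' of some move x → x'   (f-reaches).  Property
-- (a) uses only that ℋ is transversal-free.  For (b) the central step is
-- reach-face: from u one reaches any admissible height j on the face m = 0;
-- a "top" hyperedge with a high option comes from (D2), a "bottom" hyperedge
-- whose zeroing is low comes from minimality, and a (D1) chain between them
-- crosses height j, where intermediate values give the move.  Minimality is
-- a negative statement, so (b) is proved under double negation, which is
-- enough for the contradiction arguments of sg-unique.

open import Defs

open import Data.Nat using (ℕ; zero; suc; _+_; _*_; _∸_; _≤_; _<_; _%_; _/_; _≤ᵇ_; z≤n; s≤s)
open import Data.Nat.Properties
open import Data.Nat.DivMod using (m≡m%n+[m/n]*n; m%n<n; m%n≤m; [m+kn]%n≡m%n; m<n⇒m%n≡m)
open import Data.Nat.Combinatorics using (_C_; nC1≡n; nCk+nC[k+1]≡[n+1]C[k+1])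
open import Data.Nat.Solver using (module +-*-Solver)
open import Data.Bool using (true; false; if_then_else_; T)
open import Data.Bool.Properties using (T-≡)
open import Function.Bundles using (Equivalence)
open import Data.Unit using (tt)
open import Data.Fin using (Fin) renaming (zero to fzero; suc to fsuc)
open import Data.Fin.Properties using (¬∀⟶∃¬) renaming (_≟_ to _≟ᶠ_)
open import Data.Fin.Subset using (Subset; _∈_; _∉_; _⊆_; _⊂_; _∩_; _─_; ∣_∣; ⊤; ⁅_⁆; ∁; _-_)
open import Data.Fin.Subset.Properties
  using (_∈?_; nonempty?; x∈p∩q⁺; x∈p∩q⁻; x∈p∪q⁻; ∈⊤; x∈p∧x∉q⇒x∈p─q; x∈⁅x⁆; x∈⁅y⁆⇒x≡y;
         x∉p⇒x∈∁p; x∈p⇒x∉∁p; x≢y⇒x∉⁅y⁆; x∈p∧x≢y⇒x∈p-y; x∈p⇒∣p-x∣<∣p∣; p⊆q⇒∣p∣≤∣q∣; ∣⁅x⁆∣≡1)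
open import Data.Vec using ([]; lookup; tabulate)
open import Data.Vec.Properties using ([]=⇒lookup; lookup⇒[]=; lookup∘tabulate)
open import Data.Product using (∃; _×_; _,_; proj₁; proj₂)
open import Data.Sum using (_⊎_; inj₁; inj₂)
open import Data.Empty using (⊥; ⊥-elim)
open import Relation.Binary using (tri<; tri≈; tri>)
open import Relation.Binary.PropositionalEquality
open import Relation.Nullary using (¬_; yes; no)

_≤ₚ_ : ∀ {n} → Pos n → Pos n → Set
x ≤ₚ y = ∀ i → x i ≤ y i

_≗ₚ_ : ∀ {n} → Pos n → Pos n → Set
x ≗ₚ y = ∀ i → x i ≡ y i

sel : ∀ {n} → Subset n → Pos n → Pos n → Pos n
sel E a b i = if lookup E i then a i else b i

sel-case : ∀ {n} (E : Subset n) (a b : Pos n) i (P : ℕ → Set) →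
           (i ∈ E → P (a i)) → (i ∉ E → P (b i)) → P (sel E a b i)
sel-case E a b i P in-E out-E with i ∈? E
... | yes i∈E rewrite []=⇒lookup i∈E = in-E i∈E
... | no i∉E with lookup E i in eq
...   | true = ⊥-elim (i∉E (lookup⇒[]= i E eq))
...   | false = out-E i∉E

sel-in : ∀ {n} (E : Subset n) (a b : Pos n) {i} → i ∈ E → sel E a b i ≡ a i
sel-in E a b {i} i∈E = sel-case E a b i (_≡ a i) (λ _ → refl) (λ i∉E → ⊥-elim (i∉E i∈E))

sel-out : ∀ {n} (E : Subset n) (a b : Pos n) {i} → i ∉ E → sel E a b i ≡ b i
sel-out E a b {i} i∉E = sel-case E a b i (_≡ b i) (λ i∈E → ⊥-elim (i∉E i∈E)) (λ _ → refl)

sel-mono : ∀ {n} (E : Subset n) {a a' b b' : Pos n} → a ≤ₚ a' → b ≤ₚ b' → sel E a b ≤ₚ sel E a' b'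
sel-mono E a≤a' b≤b' i with lookup E i
... | true = a≤a' i
... | false = b≤b' i

Option : ∀ {n} → Pos n → Subset n → Pos n → Set
Option {n} x E x' = (∀ (i : Fin n) → i ∈ E → x' i < x i) × (∀ (i : Fin n) → i ∉ E → x' i ≡ x i)

subk : ∀ {n} → Subset n → ℕ → Pos n → Pos n
subk E k x = sel E (λ i → x i ∸ k) x

zeroOn : ∀ {n} → Subset n → Pos n → Pos n
zeroOn E x = sel E (λ _ → 0) x

upd : ∀ {n} → Fin n → ℕ → Pos n → Pos n
upd i v x j with j ≟ᶠ i
... | yes _ = v
... | no _ = x j

upd-view : ∀ {n} i v (x : Pos n) j → (j ≡ i × upd i v x j ≡ v) ⊎ (j ≢ i × upd i v x j ≡ x j)
upd-view i v x j with j ≟ᶠ i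
... | yes eq = inj₁ (eq , refl)
... | no ne = inj₂ (ne , refl)

upd-same : ∀ {n} i v (x : Pos n) → upd i v x i ≡ v
upd-same i v x with i ≟ᶠ i
... | yes _ = refl
... | no ne = ⊥-elim (ne refl)

upd-other : ∀ {n} {i j} v (x : Pos n) → j ≢ i → upd i v x j ≡ x j
upd-other {i = i} {j} v x ne with j ≟ᶠ i
... | yes eq = ⊥-elim (ne eq)
... | no _ = refl

dec : ∀ {n} → Fin n → Pos n → Pos n
dec i x = upd i (x i ∸ 1) x

dec-≤ : ∀ {n} i (x : Pos n) → dec i x ≤ₚ x
dec-≤ i x j with upd-view i (x i ∸ 1) x j
... | inj₁ (refl , e) rewrite e = m∸n≤m _ 1
... | inj₂ (_ , e) rewrite e = ≤-refl

raise : ∀ {n} → Fin n → Pos n → Pos n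
raise v q = upd v (suc (q v)) q

raise-≥ : ∀ {n} v (q : Pos n) → q ≤ₚ raise v q
raise-≥ v q l with upd-view v (suc (q v)) q l
... | inj₁ (refl , e) rewrite e = n≤1+n _
... | inj₂ (_ , e) rewrite e = ≤-refl

dec-raise : ∀ {n} v (q : Pos n) → dec v (raise v q) ≗ₚ q
dec-raise v q l with upd-view v (raise v q v ∸ 1) (raise v q) l
... | inj₁ (refl , e) rewrite e = cong (_∸ 1) (upd-same v (suc (q v)) q)
... | inj₂ (ne , e) rewrite e = upd-other (suc (q v)) q ne

size≤1-unique : ∀ {n} (D : Subset n) {a b} → ∣ D ∣ ≤ 1 → a ∈ D → b ∈ D → a ≡ b
size≤1-unique D {a} {b} size a∈D b∈D with a ≟ᶠ b
... | yes e = e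
... | no a≢b = ⊥-elim (<⇒≱ (≤-<-trans one (x∈p⇒∣p-x∣<∣p∣ a∈D)) size)
  where
  one : 1 ≤ ∣ D - a ∣
  one = ≤-trans (≤-reflexive (sym (∣⁅x⁆∣≡1 b)))
          (p⊆q⇒∣p∣≤∣q∣ (λ {z} z∈ → subst (_∈ D - a) (sym (x∈⁅y⁆⇒x≡y b z∈)) (x∈p∧x≢y⇒x∈p-y b∈D (λ e → a≢b (sym e)))))

<⇒≤∸1 : ∀ {a b} → a < b → a ≤ b ∸ 1
<⇒≤∸1 (s≤s le) = le

min≤ : ∀ {n} (x : Pos n) i → minPos x ≤ x i
min≤ {suc zero} x fzero = ≤-refl
min≤ {suc (suc n)} x fzero = m⊓n≤m (x fzero) _
min≤ {suc (suc n)} x (fsuc i) = ≤-trans (m⊓n≤n (x fzero) _) (min≤ (λ j → x (fsuc j)) i)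

min-attained : ∀ {n} (x : Pos (suc n)) → ∃ λ i → x i ≡ minPos x
min-attained {zero} x = fzero , refl
min-attained {suc n} x with ≤-total (x fzero) (minPos (λ j → x (fsuc j)))
... | inj₁ le = fzero , sym (m≤n⇒m⊓n≡m le)
... | inj₂ ge with min-attained (λ j → x (fsuc j))
... | i , eq = fsuc i , trans eq (sym (m≥n⇒m⊓n≡n ge))

min-char : ∀ {n} (x : Pos (suc n)) k i → (∀ j → k ≤ x j) → x i ≡ k → minPos x ≡ k
min-char x k i lower eq with min-attained x
... | i₀ , e₀ = ≤-antisym (subst (minPos x ≤_) eq (min≤ x i)) (subst (k ≤_) e₀ (lower i₀))

min-zero : ∀ {n} (w : Pos n) i → w i ≡ 0 → minPos w ≡ 0
min-zero w i e = n≤0⇒n≡0 (≤-trans (min≤ w i) (≤-reflexive e))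

min-lowered : ∀ {n} (x w : Pos (suc n)) k i₀ → x i₀ ≡ minPos x → (∀ l → x l ∸ k ≤ w l) →
              w i₀ ≤ minPos x ∸ k → minPos w ≡ minPos x ∸ k
min-lowered x w k i₀ xi₀ above wi₀ =
  min-char w (minPos x ∸ k) i₀ (λ l → ≤-trans (∸-monoˡ-≤ k (min≤ x l)) (above l))
    (≤-antisym wi₀ (≤-trans (≤-reflexive (cong (_∸ k) (sym xi₀))) (above i₀)))

-- The sum of the coordinates; it bounds the length of descents in ≤ₚ.
sumP : ∀ {n} → Pos n → ℕ
sumP {zero} x = 0
sumP {suc n} x = x fzero + sumP (λ j → x (fsuc j))

sumP-mono : ∀ {n} (x y : Pos n) → x ≤ₚ y → sumP x ≤ sumP y
sumP-mono {zero} x y le = z≤n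
sumP-mono {suc n} x y le = +-mono-≤ (le fzero) (sumP-mono _ _ (λ j → le (fsuc j)))

sumP-< : ∀ {n} (x y : Pos n) i → x ≤ₚ y → x i < y i → sumP x < sumP y
sumP-< {suc n} x y fzero le lt = +-mono-<-≤ lt (sumP-mono _ _ (λ j → le (fsuc j)))
sumP-< {suc n} x y (fsuc i) le lt = +-mono-≤-< (le fzero) (sumP-< _ _ i (λ j → le (fsuc j)) lt)

move-≤ : ∀ {n} {ℋ : Family n} {x x'} → Move ℋ x x' → x' ≤ₚ x
move-≤ (E , _ , lt , eq) i with i ∈? E
... | yes i∈E = <⇒≤ (lt i i∈E)
... | no i∉E = ≤-reflexive (eq i i∉E)

move-shift : ∀ {n} {ℋ : Family n} {u w} → Move ℋ u w → ∀ c → Move ℋ (λ i → u i + c) (λ i → w i + c)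
move-shift (E , hE , lt , eq) c = E , hE , (λ i i∈E → +-monoˡ-< c (lt i i∈E)) , (λ i i∉E → cong (_+ c) (eq i i∉E))

move-resp : ∀ {n} {ℋ : Family n} {a b w} → a ≗ₚ b → Move ℋ a w → Move ℋ b w
move-resp a≗b (E , hE , lt , eq) = E , hE , (λ i i∈E → subst (_ <_) (a≗b i) (lt i i∈E)) , (λ i i∉E → trans (eq i i∉E) (a≗b i))

module Height {n} (ℋ : Family n) (h : Pos n → ℕ) (isHeight : IsHeight ℋ h) where

  longest : ∀ x → Play ℋ x (h x)
  longest x = proj₁ (isHeight x)

  h-max : ∀ x k → Play ℋ x k → k ≤ h x
  h-max x = proj₂ (isHeight x)

  -- A play from x can be replayed from any y ≥ x: copy each move on its
  -- hyperedge and keep the other coordinates of y.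
  play-mono : ∀ {x y k} → Play ℋ x k → x ≤ₚ y → Play ℋ y k
  play-mono stop _ = stop
  play-mono {x} {y} (step {x' = x'} (E , hE , lt , eq) rest) le =
    step (E , hE , lt' , (λ i i∉E → sel-out E x' y i∉E)) (play-mono rest le')
    where
    lt' : ∀ i → i ∈ E → sel E x' y i < y i
    lt' i i∈E rewrite sel-in E x' y i∈E = <-≤-trans (lt i i∈E) (le i)
    le' : x' ≤ₚ sel E x' y
    le' i = sel-case E x' y i (x' i ≤_) (λ _ → ≤-refl) (λ i∉E → ≤-trans (≤-reflexive (eq i i∉E)) (le i))

  h-mono : ∀ {x y} → x ≤ₚ y → h x ≤ h y
  h-mono {x} {y} le = h-max y (h x) (play-mono (longest x) le)

  h-resp : ∀ {x y} → x ≗ₚ y → h x ≡ h y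
  h-resp eq = ≤-antisym (h-mono (λ i → ≤-reflexive (eq i))) (h-mono (λ i → ≤-reflexive (sym (eq i))))

  h-move : ∀ {x x'} → Move ℋ x x' → h x' < h x
  h-move {x} {x'} mv = h-max x (suc (h x')) (step mv (longest x'))

  -- Lowering one coordinate costs at most one move: the first move of a
  -- play either uses coordinate i (then the rest of the play survives) or
  -- not (then it can be made from dec i x as well).
  play-dec : ∀ {x k} i → Play ℋ x (suc k) → Play ℋ (dec i x) k
  play-dec i (step mv stop) = stop
  play-dec {x} i (step {x' = x'} (E , hE , lt , eq) rest@(step _ _)) with i ∈? E
  ... | yes i∈E = play-mono rest below
    where
    below : x' ≤ₚ dec i x
    below j with j ≟ᶠ i
    ... | yes refl = <⇒≤∸1 (lt i i∈E)
    ... | no _ with j ∈? E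
    ...   | yes j∈E = <⇒≤ (lt j j∈E)
    ...   | no j∉E = ≤-reflexive (eq j j∉E)
  ... | no i∉E = step (E , hE , lt' , eq') (play-dec i rest)
    where
    lt' : ∀ j → j ∈ E → dec i x' j < dec i x j
    lt' j j∈E with j ≟ᶠ i
    ... | yes refl = ⊥-elim (i∉E j∈E)
    ... | no _ = lt j j∈E
    eq' : ∀ j → j ∉ E → dec i x' j ≡ dec i x j
    eq' j j∉E with j ≟ᶠ i
    ... | yes refl = cong (_∸ 1) (eq j j∉E)
    ... | no _ = eq j j∉E

  h-dec : ∀ i x → h x ≤ suc (h (dec i x))
  h-dec i x = bound (h x) (longest x)
    where
    bound : ∀ k → Play ℋ x k → k ≤ suc (h (dec i x))
    bound zero _ = z≤n
    bound (suc k) p = s≤s (h-max _ k (play-dec i p))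

  h-raise : ∀ v q → h (raise v q) ≤ suc (h q)
  h-raise v q = ≤-trans (h-dec v (raise v q)) (s≤s (≤-reflexive (h-resp (dec-raise v q))))

  h-upd : ∀ r i v x → x i ≡ v + r → h x ≤ h (upd i v x) + r
  h-upd zero i v x e = ≤-reflexive (trans (h-resp same) (sym (+-identityʳ _)))
    where
    same : x ≗ₚ upd i v x
    same j with upd-view i v x j
    ... | inj₁ (refl , e₂) = trans e (trans (+-identityʳ v) (sym e₂))
    ... | inj₂ (_ , e₂) = sym e₂
  h-upd (suc r) i v x e = begin
      h x                              ≤⟨ h-dec i x ⟩
      suc (h (dec i x))                ≤⟨ s≤s (h-upd r i v (dec i x) e') ⟩
      suc (h (upd i v (dec i x)) + r)  ≡⟨ cong (λ q → suc (q + r)) (h-resp same) ⟩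
      suc (h (upd i v x) + r)          ≡⟨ sym (+-suc _ r) ⟩
      h (upd i v x) + suc r            ∎
    where
    open ≤-Reasoning
    e' : dec i x i ≡ v + r
    e' = trans (upd-same i (x i ∸ 1) x) (cong (_∸ 1) (trans e (+-suc v r)))
    same : upd i v (dec i x) ≗ₚ upd i v x
    same j with upd-view i v (dec i x) j | upd-view i v x j
    ... | inj₁ (_ , e₁) | inj₁ (_ , e₂) = trans e₁ (sym e₂)
    ... | inj₁ (eq , _) | inj₂ (ne , _) = ⊥-elim (ne eq)
    ... | inj₂ (ne , _) | inj₁ (eq , _) = ⊥-elim (ne eq)
    ... | inj₂ (ne , e₁) | inj₂ (_ , e₂) = trans e₁ (trans (upd-other (x i ∸ 1) x ne) (sym e₂))

  prepend : ∀ E → ℋ E → ∀ k x r → (∀ j → j ∈ E → k ≤ x j) → Play ℋ (subk E k x) r → Play ℋ x (k + r)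
  prepend E hE zero x r le p = play-mono p (λ j → sel-case E (λ j → x j ∸ 0) x j (_≤ x j) (λ _ → ≤-refl) (λ _ → ≤-refl))
  prepend E hE (suc k) x r le p =
    subst (Play ℋ x) (+-suc k r) (prepend E hE k x (suc r) (λ j j∈E → ≤-trans (n≤1+n k) (le j j∈E)) (step mv p))
    where
    mv : Move ℋ (subk E k x) (subk E (suc k) x)
    mv = E , hE , lt , (λ j j∉E → trans (sel-out E (λ j → x j ∸ suc k) x j∉E) (sym (sel-out E (λ j → x j ∸ k) x j∉E)))
      where
      lt : ∀ j → j ∈ E → subk E (suc k) x j < subk E k x j
      lt j j∈E rewrite sel-in E (λ j → x j ∸ suc k) x j∈E | sel-in E (λ j → x j ∸ k) x j∈E =
        ∸-monoʳ-< {x j} {suc k} {k} (n<1+n k) (le j j∈E)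

  h-subk : ∀ E → ℋ E → ∀ k x → (∀ j → j ∈ E → k ≤ x j) → k + h (subk E k x) ≤ h x
  h-subk E hE k x le = h-max x _ (prepend E hE k x _ le (longest _))

  h-≥-edge : ∀ E → ℋ E → ∀ k x → (∀ j → j ∈ E → k ≤ x j) → k ≤ h x
  h-≥-edge E hE k x le = ≤-trans (m≤m+n k _) (h-subk E hE k x le)

  h-shift : ∀ E → ℋ E → ∀ x k → (∀ i → k ≤ x i) → k + h (λ i → x i ∸ k) ≤ h x
  h-shift E hE x k le = ≤-trans (+-monoʳ-≤ k (h-mono below)) (h-subk E hE k x (λ j _ → le j))
    where
    below : (λ i → x i ∸ k) ≤ₚ subk E k x
    below j = sel-case E (λ j → x j ∸ k) x j (x j ∸ k ≤_) (λ _ → ≤-refl) (λ _ → m∸n≤m _ k)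

  -- Intermediate values: between a ≤ₚ b every height in [h a, h b] is
  -- attained, because lowering one coordinate lowers h by at most one.
  -- The recursion is on a bound F for sumP b.
  h-ivt : ∀ F (a b : Pos n) j → sumP b ≤ F → a ≤ₚ b → h a ≤ j → j ≤ h b →
          ∃ λ w → a ≤ₚ w × w ≤ₚ b × h w ≡ j
  h-ivt F a b j sb ab ha hb with h b ≟ j
  ... | yes e = b , ab , (λ _ → ≤-refl) , e
  ... | no ne with ¬∀⟶∃¬ n (λ i → b i ≤ a i) (λ i → b i ≤? a i)
                      (λ b≤a → ne (≤-antisym (≤-trans (h-mono b≤a) ha) hb))
  ... | i , b≰a = descend F sb
    where
    b' : Pos n
    b' = dec i b
    ab' : a ≤ₚ b'
    ab' l with upd-view i (b i ∸ 1) b l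
    ... | inj₁ (refl , e) rewrite e = <⇒≤∸1 (≰⇒> b≰a)
    ... | inj₂ (_ , e) rewrite e = ab l
    hb' : j ≤ h b'
    hb' = ≤-pred (≤-trans (≤∧≢⇒< hb (λ e → ne (sym e))) (h-dec i b))
    smaller : sumP b' < sumP b
    smaller = sumP-< b' b i (dec-≤ i b)
      (subst (_< b i) (sym (upd-same i (b i ∸ 1) b)) (∸-monoʳ-< {b i} {1} {0} (s≤s z≤n) (≤-trans (s≤s z≤n) (≰⇒> b≰a))))
    descend : ∀ F → sumP b ≤ F → ∃ λ w → a ≤ₚ w × w ≤ₚ b × h w ≡ j
    descend zero sb = ⊥-elim (<⇒≱ (≤-trans smaller sb) z≤n)
    descend (suc F) sb with h-ivt F a b' j (≤-pred (≤-trans smaller sb)) ab' ha hb'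
    ... | w , aw , wb' , hw = w , aw , (λ l → ≤-trans (wb' l) (dec-≤ i b l)) , hw

  move-to-height : ∀ {x E Q} a j → ℋ E → Option x E Q → a ≤ₚ Q → (∀ i → i ∉ E → a i ≡ x i) →
                   h a ≤ j → j ≤ h Q → ∃ λ w → Move ℋ x w × a ≤ₚ w × w ≤ₚ Q × h w ≡ j
  move-to-height {x} {E} {Q} a j hE (ltQ , eqQ) aQ ax ha jQ with h-ivt (sumP Q) a Q j ≤-refl aQ ha jQ
  ... | w , aw , wQ , hw = w , (E , hE , lt , eq) , aw , wQ , hw
    where
    lt : ∀ i → i ∈ E → w i < x i
    lt i i∈E = ≤-<-trans (wQ i) (ltQ i i∈E)
    eq : ∀ i → i ∉ E → w i ≡ x i
    eq i i∉E = ≤-antisym (≤-trans (wQ i) (≤-reflexive (eqQ i i∉E))) (subst (_≤ w i) (ax i i∉E) (aw i))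

  sg-unique : ∀ (F g : Pos n → ℕ) → IsSG ℋ g →
              (∀ {x x'} → Move ℋ x x' → F x' ≢ F x) →
              (∀ x j → j < F x → ¬ ¬ (∃ λ x' → Move ℋ x x' × F x' ≡ j)) → ∀ x → g x ≡ F x
  sg-unique F g isSG separates reaches x = by-height (h x) x ≤-refl
    where
    from-options : ∀ x → (∀ x' → Move ℋ x x' → g x' ≡ F x') → g x ≡ F x
    from-options x options with isSG x | <-cmp (g x) (F x)
    ... | missing , _ | tri< g<F _ _ = ⊥-elim (reaches x (g x) g<F (λ (x' , mv , e) → missing (x' , mv , trans (options x' mv) e)))
    ... | _ | tri≈ _ e _ = e
    ... | _ , present | tri> _ _ F<g with present (F x) F<g
    ...   | x' , mv , e = ⊥-elim (separates mv (trans (sym (options x' mv)) e))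
    by-height : ∀ K x → h x ≤ K → g x ≡ F x
    by-height zero x hx≤0 = from-options x (λ x' mv → ⊥-elim (<⇒≱ (<-≤-trans (h-move mv) hx≤0) z≤n))
    by-height (suc K) x hx≤K = from-options x (λ x' mv → by-height K x' (≤-pred (<-≤-trans (h-move mv) hx≤K)))

-- Arithmetic of triangular numbers C(y,2) and of the residue regime.

C-suc : ∀ y → suc y C 2 ≡ y C 2 + y
C-suc y = trans (sym (nCk+nC[k+1]≡[n+1]C[k+1] y 1)) (trans (cong (_+ y C 2) (nC1≡n y)) (+-comm y (y C 2)))

C-strict : ∀ {y y'} → y < y' → y C 2 + y ≤ y' C 2
C-strict {y} {y'} y<y' with m≤n⇒∃[o]m+o≡n y<y'
... | o , refl = subst (_≤ (suc y + o) C 2) (C-suc y) (grow (suc y) o)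
  where
  grow : ∀ y o → y C 2 ≤ (y + o) C 2
  grow y zero = ≤-reflexive (cong (_C 2) (sym (+-identityʳ y)))
  grow y (suc o) = ≤-trans (grow y o) (≤-trans (m≤m+n _ (y + o))
                     (≤-reflexive (trans (sym (C-suc (y + o))) (cong (_C 2) (sym (+-suc y o))))))

C-mono : ∀ {y y'} → y ≤ y' → y C 2 ≤ y' C 2
C-mono {y} y≤y' with m≤n⇒m<n∨m≡n y≤y'
... | inj₁ y<y' = ≤-trans (m≤m+n _ y) (C-strict y<y')
... | inj₂ refl = ≤-refl

block-exists : ∀ j → ∃ λ t → suc t C 2 ≤ j × j < suc t C 2 + suc t
block-exists zero = 0 , z≤n , s≤s z≤n
block-exists (suc j) with block-exists j
... | t , lo , hi with suc j <? suc t C 2 + suc t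
... | yes lt = t , ≤-trans lo (n≤1+n j) , lt
... | no nlt = suc t , ≤-reflexive start , subst (suc j <_) (sym (cong (_+ suc (suc t)) start))
                 (subst (suc (suc j) ≤_) (sym (+-suc (suc j) (suc t))) (s≤s (m≤m+n (suc j) (suc t))))
  where
  start : suc (suc t) C 2 ≡ suc j
  start = trans (C-suc (suc t)) (≤-antisym (≮⇒≥ nlt) hi)

block-unique : ∀ {y y' r r'} → y C 2 + r ≡ y' C 2 + r' → r < y → r' < y' → y ≡ y'
block-unique {y} {y'} {r} {r'} e lt lt' with <-cmp y y'
... | tri≈ _ eq _ = eq
... | tri< y<y' _ _ = ⊥-elim (<⇒≱ (<-≤-trans (+-monoʳ-< (y C 2) lt) (≤-trans (C-strict y<y') (m≤m+n _ r'))) (≤-reflexive (sym e)))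
... | tri> _ _ y'<y = ⊥-elim (<⇒≱ (<-≤-trans (+-monoʳ-< (y' C 2) lt') (≤-trans (C-strict y'<y) (m≤m+n _ r))) (≤-reflexive e))

mod-separated : ∀ t b d → 0 < d → d < suc t → (b + d) % suc t ≢ b % suc t
mod-separated t b d 0<d d<y e = compare
  where
  y : ℕ
  y = suc t
  Q : ℕ
  Q = (b + d) / y
  q : ℕ
  q = b / y
  quotients : Q * y ≡ q * y + d
  quotients = +-cancelˡ-≡ (b % y) _ _ (begin
    b % y + Q * y        ≡⟨ cong (_+ Q * y) (sym e) ⟩
    (b + d) % y + Q * y  ≡⟨ sym (m≡m%n+[m/n]*n (b + d) y) ⟩
    b + d                ≡⟨ cong (_+ d) (m≡m%n+[m/n]*n b y) ⟩
    b % y + q * y + d    ≡⟨ +-assoc (b % y) (q * y) d ⟩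
    b % y + (q * y + d)  ∎)
    where open ≡-Reasoning
  compare : ⊥
  compare with Q ≤? q
  ... | yes Q≤q = <⇒≱ (m<m+n (q * y) 0<d) (≤-trans (≤-reflexive (sym quotients)) (*-monoˡ-≤ y Q≤q))
  ... | no Q≰q = <⇒≱ d<y (+-cancelˡ-≤ (q * y) _ _
                   (≤-trans (≤-reflexive (+-comm (q * y) y)) (≤-trans (*-monoˡ-≤ y (≰⇒> Q≰q)) (≤-reflexive quotients))))

mod-small : ∀ t r k → r < suc t → (r + k * suc t) % suc t ≡ r
mod-small t r k r<y = trans ([m+kn]%n≡m%n r k (suc t)) (m<n⇒m%n≡m r<y)

-- The value of f in the residue regime m > c, with c = C(t+1,2).
Residue : ℕ → ℕ → ℕ → ℕ
Residue c t m = c + ((m ∸ c ∸ 1) % suc t)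

peel : ∀ a o → suc a + o ∸ a ∸ 1 ≡ o
peel a o = trans (∸-+-assoc (suc a + o) a 1) (trans (cong (suc a + o ∸_) (+-comm a 1)) (m+n∸m≡n (suc a) o))

residue-form : ∀ c t o → Residue c t (suc c + o) ≡ c + o % suc t
residue-form c t o = cong (λ z → c + z % suc t) (peel c o)

residue-below : ∀ {c t m} → c < m → Residue c t m < m
residue-below {c} {t} c<m with m≤n⇒∃[o]m+o≡n c<m
... | o , refl rewrite residue-form c t o = s≤s (+-monoʳ-≤ c (m%n≤m o (suc t)))

residue-separated : ∀ {c t m m'} → c < m' → m' < m → m ∸ m' ≤ t → Residue c t m' ≢ Residue c t m
residue-separated {c} {t} c<m' m'<m gap e with m≤n⇒∃[o]m+o≡n c<m' | m≤n⇒∃[o]m+o≡n m'<m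
... | o , refl | p , refl =
  mod-separated t o (suc p) (s≤s z≤n) (s≤s (subst (_≤ t) gap≡ gap))
    (sym (+-cancelˡ-≡ c _ _ (begin
      c + o % suc t                       ≡⟨ sym (residue-form c t o) ⟩
      Residue c t (suc c + o)             ≡⟨ e ⟩
      Residue c t (suc (suc c + o) + p)   ≡⟨ cong (Residue c t) m≡ ⟩
      Residue c t (suc c + (o + suc p))   ≡⟨ residue-form c t (o + suc p) ⟩
      c + (o + suc p) % suc t             ∎)))
  where
  open ≡-Reasoning
  m≡ : suc (suc c + o) + p ≡ suc c + (o + suc p)
  m≡ = trans (sym (+-suc (suc c + o) p)) (+-assoc (suc c) o (suc p))
  gap≡ : suc (suc c + o) + p ∸ (suc c + o) ≡ suc p
  gap≡ = trans (cong (_∸ (suc c + o)) (sym (+-suc (suc c + o) p))) (m+n∸m≡n (suc c + o) (suc p))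

drop-middle : ∀ a d b → suc a + (d + b) ∸ d ≡ suc a + b
drop-middle a d b = trans (cong (_∸ d) (solve 3 (λ a d b → con 1 :+ a :+ (d :+ b) := d :+ (con 1 :+ a :+ b)) refl a d b))
                          (m+n∸m≡n d (suc a + b))
  where open +-*-Solver

residue-hit-below : ∀ {m c r t d} → r < suc t → c + r < m → d ≡ (m ∸ (c + r) ∸ 1) % suc t →
  d ≤ t × d ≤ m × c + r < m ∸ d × Residue c t (m ∸ d) ≡ c + r
residue-hit-below {m} {c} {r} {t} {d} r<y j<m refl with m≤n⇒∃[o]m+o≡n j<m
... | o , refl = ≤-pred (subst (_< suc t) (sym d≡) (m%n<n o y)) , d≤m , j<m-d , value
  where
  y : ℕ
  y = suc t
  j : ℕ
  j = c + r
  Q : ℕ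
  Q = o / y * y
  d≡ : d ≡ o % y
  d≡ = cong (_% y) (peel j o)
  m≡ : suc j + o ≡ suc j + (d + Q)
  m≡ = cong (suc j +_) (trans (m≡m%n+[m/n]*n o y) (cong (_+ Q) (sym d≡)))
  m-d : suc j + o ∸ d ≡ suc j + Q
  m-d = trans (cong (_∸ d) m≡) (drop-middle j d Q)
  d≤m : d ≤ suc j + o
  d≤m = subst (_≤ suc j + o) (sym d≡) (≤-trans (m%n≤m o y) (m≤n+m o _))
  j<m-d : j < suc j + o ∸ d
  j<m-d = subst (j <_) (sym m-d) (s≤s (m≤m+n j Q))
  value : Residue c t (suc j + o ∸ d) ≡ j
  value = begin
    Residue c t (suc j + o ∸ d)   ≡⟨ cong (Residue c t) (trans m-d (cong suc (+-assoc c r Q))) ⟩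
    Residue c t (suc c + (r + Q)) ≡⟨ residue-form c t (r + Q) ⟩
    c + (r + Q) % y               ≡⟨ cong (c +_) (mod-small t r (o / y) r<y) ⟩
    j                             ∎
    where open ≡-Reasoning

residue-hit-above : ∀ {m c j t} → c < m → c ≤ j → j < Residue c t m →
  let d = Residue c t m ∸ j in d ≤ t × 1 ≤ d × d ≤ m × c < m ∸ d × Residue c t (m ∸ d) ≡ j
residue-hit-above {m} {c} {j} {t} c<m c≤j j<res with m≤n⇒∃[o]m+o≡n c<m | m≤n⇒∃[o]m+o≡n c≤j
... | o , refl | s , refl = d≤t , 1≤d , d≤m , c<m-d , value
  where
  open ≡-Reasoning
  y : ℕ
  y = suc t
  R : ℕ
  R = o % y
  Q : ℕ
  Q = o / y * y
  d : ℕ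
  d = Residue c t (suc c + o) ∸ (c + s)
  d≡ : d ≡ R ∸ s
  d≡ = trans (cong (_∸ (c + s)) (residue-form c t o)) ([m+n]∸[m+o]≡n∸o c R s)
  s<R : s < R
  s<R = +-cancelˡ-< c s R (subst (c + s <_) (residue-form c t o) j<res)
  R≡ : R ≡ d + s
  R≡ = trans (sym (m∸n+n≡m (<⇒≤ s<R))) (cong (_+ s) (sym d≡))
  m-d : suc c + o ∸ d ≡ suc c + (s + Q)
  m-d = begin
    suc c + o ∸ d              ≡⟨ cong (λ z → suc c + z ∸ d) (m≡m%n+[m/n]*n o y) ⟩
    suc c + (R + Q) ∸ d        ≡⟨ cong (λ z → suc c + (z + Q) ∸ d) R≡ ⟩
    suc c + (d + s + Q) ∸ d    ≡⟨ cong (λ z → suc c + z ∸ d) (+-assoc d s Q) ⟩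
    suc c + (d + (s + Q)) ∸ d  ≡⟨ drop-middle c d (s + Q) ⟩
    suc c + (s + Q)            ∎
  d≤R : d ≤ R
  d≤R = subst (_≤ R) (sym d≡) (m∸n≤m R s)
  d≤t : d ≤ t
  d≤t = ≤-pred (≤-<-trans d≤R (m%n<n o y))
  1≤d : 1 ≤ d
  1≤d = subst (1 ≤_) (sym d≡) (m<n⇒0<n∸m s<R)
  d≤m : d ≤ suc c + o
  d≤m = ≤-trans d≤R (≤-trans (m%n≤m o y) (m≤n+m o _))
  c<m-d : c < suc c + o ∸ d
  c<m-d = subst (c <_) (sym m-d) (s≤s (m≤m+n c _))
  value : Residue c t (suc c + o ∸ d) ≡ c + s
  value = begin
    Residue c t (suc c + o ∸ d)    ≡⟨ cong (Residue c t) m-d ⟩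
    Residue c t (suc c + (s + Q))  ≡⟨ residue-form c t (s + Q) ⟩
    c + (s + Q) % y                ≡⟨ cong (c +_) (mod-small t s (o / y) (≤-<-trans (<⇒≤ s<R) (m%n<n o y))) ⟩
    c + s                          ∎

module Grundy {n'} (ℋ : Family (suc n')) (h : Pos (suc n') → ℕ) (isHeight : IsHeight ℋ h) where

  open Height ℋ h isHeight

  N : ℕ
  N = suc n'

  level : Pos N → ℕ
  level x = h (subMin x)

  cut : Pos N → ℕ
  cut x = suc (level x) C 2

  f : Pos N → ℕ
  f = fJM h

  f-low : ∀ x → minPos x ≤ cut x → f x ≡ h x
  f-low x le with minPos x ≤ᵇ cut x in eq
  ... | true = refl
  ... | false = ⊥-elim (subst T eq (≤⇒≤ᵇ le))

  f-high : ∀ x → cut x < minPos x → f x ≡ Residue (cut x) (level x) (minPos x)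
  f-high x lt with minPos x ≤ᵇ cut x in eq
  ... | true = ⊥-elim (<⇒≱ lt (≤ᵇ⇒≤ _ _ (subst T (sym eq) tt)))
  ... | false = refl

  f-shape : ∀ x {m t} → minPos x ≡ m → level x ≡ t → suc t C 2 < m → f x ≡ Residue (suc t C 2) t m
  f-shape x refl refl high = f-high x high

  level-grows : ∀ x w k → (∀ l → x l ∸ k ≤ w l) → minPos w ≡ minPos x ∸ k → k ≤ minPos x → level x ≤ level w
  level-grows x w k above mw k≤m = h-mono λ l → begin
    x l ∸ minPos x                ≡⟨ sym (cong (x l ∸_) (m+[n∸m]≡n k≤m)) ⟩
    x l ∸ (k + (minPos x ∸ k))    ≡⟨ sym (∸-+-assoc (x l) k (minPos x ∸ k)) ⟩
    x l ∸ k ∸ (minPos x ∸ k)      ≤⟨ ∸-monoˡ-≤ (minPos x ∸ k) (above l) ⟩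
    w l ∸ (minPos x ∸ k)          ≡⟨ cong (w l ∸_) (sym mw) ⟩
    w l ∸ minPos w                ∎
    where open ≤-Reasoning

  low-preserved : ∀ x w k → (∀ l → x l ∸ k ≤ w l) → minPos w ≡ minPos x ∸ k → k ≤ minPos x →
                  minPos x ≤ cut x → minPos w ≤ cut w
  low-preserved x w k above mw k≤m low = begin
    minPos w        ≡⟨ mw ⟩
    minPos x ∸ k    ≤⟨ m∸n≤m (minPos x) k ⟩
    minPos x        ≤⟨ low ⟩
    cut x           ≤⟨ C-mono (s≤s (level-grows x w k above mw k≤m)) ⟩
    cut w           ∎
    where open ≤-Reasoning

  module Separation (E₀ : Subset N) (hE₀ : ℋ E₀) (transversalFree : TransversalFree ℋ) where

    -- Lowering all coordinates by m(x) takes m(x) moves along E₀.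
    m+level≤h : ∀ x → minPos x + level x ≤ h x
    m+level≤h x = h-shift E₀ hE₀ x (minPos x) (min≤ x)

    f≤h : ∀ x → f x ≤ h x
    f≤h x with minPos x ≤? cut x
    ... | yes low = ≤-reflexive (f-low x low)
    ... | no high = begin
      f x                                         ≡⟨ f-high x (≰⇒> high) ⟩
      Residue (cut x) (level x) (minPos x)        ≤⟨ <⇒≤ (residue-below (≰⇒> high)) ⟩
      minPos x                                    ≤⟨ m≤m+n _ _ ⟩
      minPos x + level x                          ≤⟨ m+level≤h x ⟩
      h x                                         ∎
      where open ≤-Reasoning

    -- If x ≥ k off some hyperedge E, then h x ≥ k: otherwise every hyperedge
    -- meets E (a hyperedge missing E would give h x ≥ k by h-≥-edge), so E
    -- would be a transversal.
    h-≥-off-edge : ∀ E → ℋ E → ∀ x k → (∀ l → l ∉ E → k ≤ x l) → k ≤ h x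
    h-≥-off-edge E hE x k off with k ≤? h x
    ... | yes le = le
    ... | no nle = ⊥-elim (transversalFree E hE meets)
      where
      meets : Transversal ℋ E
      meets E' hE' with nonempty? (E ∩ E')
      ... | yes ne = ne
      ... | no disjoint = ⊥-elim (nle (h-≥-edge E' hE' k x
              (λ l l∈E' → off l (λ l∈E → disjoint (l , x∈p∩q⁺ (l∈E , l∈E'))))))

    move-cases : ∀ {x x'} → Move ℋ x x' →
      (minPos x' ≡ minPos x × Move ℋ (subMin x) (subMin x')) ⊎
      (minPos x' < minPos x × minPos x ≤ h x' × minPos x ∸ minPos x' ≤ level x')
    move-cases {x} {x'} mv@(E , hE , lt , eq) with min-attained x
    ... | i₀ , e₀ with m≤n⇒m<n∨m≡n (≤-trans (min≤ x' i₀) (≤-trans (move-≤ mv i₀) (≤-reflexive e₀)))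
    ... | inj₂ same = inj₁ (same , E , hE , lt' , (λ i i∉E → cong₂ _∸_ (eq i i∉E) same))
      where
      lt' : ∀ i → i ∈ E → subMin x' i < subMin x i
      lt' i i∈E = subst (λ q → x' i ∸ q < x i ∸ minPos x) (sym same)
                    (∸-monoˡ-< (lt i i∈E) (subst (_≤ x' i) same (min≤ x' i)))
    ... | inj₁ lower = inj₂ (lower ,
          h-≥-off-edge E hE x' _ (λ l l∉E → subst (minPos x ≤_) (sym (eq l l∉E)) (min≤ x l)) ,
          h-≥-off-edge E hE (subMin x') _ (λ l l∉E → subst (λ q → minPos x ∸ minPos x' ≤ q ∸ minPos x')
                                                   (sym (eq l l∉E)) (∸-monoˡ-≤ (minPos x') (min≤ x l))))

    -- Property (a), residue regime, minimum kept: t drops, so the block of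
    -- f x' lies strictly below the block of f x.
    separated-kept : ∀ {x x'} → cut x < minPos x → minPos x' ≡ minPos x →
                     Move ℋ (subMin x) (subMin x') → f x' < f x
    separated-kept {x} {x'} high same mv = begin-strict
        f x'                                                   ≡⟨ f-high x' high' ⟩
        cut x' + ((minPos x' ∸ cut x' ∸ 1) % suc (level x'))   <⟨ +-monoʳ-< (cut x') (m%n<n (minPos x' ∸ cut x' ∸ 1) (suc (level x'))) ⟩
        cut x' + suc (level x')                                ≤⟨ blocks ⟩
        cut x                                                  ≤⟨ m≤m+n _ _ ⟩
        Residue (cut x) (level x) (minPos x)                   ≡⟨ sym (f-high x high) ⟩
        f x                                                    ∎
      where
      open ≤-Reasoning
      blocks : cut x' + suc (level x') ≤ cut x
      blocks = C-strict (s≤s (h-move mv))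
      high' : cut x' < minPos x'
      high' = ≤-<-trans (≤-trans (m≤m+n _ _) blocks) (subst (cut x <_) (sym same) high)

    separated-lowered : ∀ {x x'} → cut x < minPos x → minPos x' < minPos x → minPos x ≤ h x' →
                        minPos x ∸ minPos x' ≤ level x' → f x' ≢ f x
    separated-lowered {x} {x'} high lower tall gap with minPos x' ≤? cut x'
    ... | yes low' = λ e → <⇒≢ below (sym e)
      where
      below : f x < f x'
      below = begin-strict
        f x                                    ≡⟨ f-high x high ⟩
        Residue (cut x) (level x) (minPos x)   <⟨ residue-below high ⟩
        minPos x                               ≤⟨ tall ⟩
        h x'                                   ≡⟨ sym (f-low x' low') ⟩
        f x'                                   ∎
        where open ≤-Reasoning
    ... | no high' = λ e → residue-separated (subst (_< minPos x') (same-cut e) (≰⇒> high')) lower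
                             (subst (minPos x ∸ minPos x' ≤_) (same-level e) gap) (residues e)
      where
      values : f x' ≡ f x → Residue (cut x') (level x') (minPos x') ≡ Residue (cut x) (level x) (minPos x)
      values e = trans (sym (f-high x' (≰⇒> high'))) (trans e (f-high x high))
      same-level : f x' ≡ f x → level x' ≡ level x
      same-level e = suc-injective (block-unique (values e) (m%n<n (minPos x' ∸ cut x' ∸ 1) (suc (level x'))) (m%n<n (minPos x ∸ cut x ∸ 1) (suc (level x))))
      same-cut : f x' ≡ f x → cut x' ≡ cut x
      same-cut e = cong (λ z → suc z C 2) (same-level e)
      residues : (e : f x' ≡ f x) → Residue (cut x) (level x) (minPos x') ≡ Residue (cut x) (level x) (minPos x)
      residues e = trans (cong₂ (λ c t → Residue c t (minPos x')) (sym (same-cut e)) (sym (same-level e))) (values e)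

    f-separated : ∀ {x x'} → Move ℋ x x' → f x' ≢ f x
    f-separated {x} {x'} mv with minPos x ≤? cut x
    ... | yes low = <⇒≢ (≤-<-trans (f≤h x') (<-≤-trans (h-move mv) (≤-reflexive (sym (f-low x low)))))
    ... | no high with move-cases mv
    ...   | inj₁ (same , mv₀) = <⇒≢ (separated-kept (≰⇒> high) same mv₀)
    ...   | inj₂ (lower , tall , gap) = separated-lowered (≰⇒> high) lower tall gap

  module Reach (E₀ : Subset N) (hE₀ : ℋ E₀) (minimal : MinimalTransversalFree ℋ)
               (chains : D1 ℋ) (descents : D2 ℋ) where

    open Separation E₀ hE₀ (proj₁ minimal)

    ¬¬_ : Set → Set
    ¬¬ A = ¬ ¬ A

    Playable : Pos N → Subset N → Set
    Playable u E = ∀ i → i ∈ E → 1 ≤ u i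

    FaceMove : Pos N → ℕ → Set
    FaceMove u j = ∃ λ w → Move ℋ u w × minPos w ≡ 0 × h w ≡ j

    FaceOption : Pos N → Subset N → ℕ → Set
    FaceOption u E j = ∃ λ Q → Option u E Q × minPos Q ≡ 0 × j ≤ h Q

    zeroOn-below : ∀ E (u Q : Pos N) → Option u E Q → zeroOn E u ≤ₚ Q
    zeroOn-below E u Q (_ , eqQ) i =
      sel-case E (λ _ → 0) u i (_≤ Q i) (λ _ → z≤n) (λ i∉E → ≤-reflexive (sym (eqQ i i∉E)))

    face-move : ∀ {u j E} → ℋ E → FaceOption u E j → h (zeroOn E u) ≤ j → FaceMove u j
    face-move {u} {j} {E} hE (Q , opt , mQ , jQ) hz
      with move-to-height (zeroOn E u) j hE opt (zeroOn-below E u Q opt) (λ i i∉E → sel-out E (λ _ → 0) u i∉E) hz jQ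
    ... | w , mv , _ , wQ , hw with min-attained Q
    ...   | i₀ , e₀ = w , mv , n≤0⇒n≡0 (≤-trans (min≤ w i₀) (≤-trans (wQ i₀) (≤-reflexive (trans e₀ mQ)))) , hw

    anchor : ∀ x → 0 < minPos x →
             ∃ λ E → ℋ E × h (subχ x E) ≡ h x ∸ 1 × ∃ λ i₀ → i₀ ∈ E × x i₀ ≡ minPos x
    anchor x pos with descents h isHeight x pos
    ... | E , hE , drop , lowered with min-attained (subχ x E)
    ...   | i₀ , e₀ with i₀ ∈? E
    ...     | yes i₀∈E = E , hE , drop , i₀ , i₀∈E ,
                ∸-cancelʳ-≡ (≤-trans pos (min≤ x i₀)) pos (trans (sym (sel-in E (λ i → x i ∸ 1) x i₀∈E)) (trans e₀ lowered))
    ...     | no i₀∉E = ⊥-elim (<⇒≱ (≤-<-trans (≤-reflexive (trans (sym (sel-out E (λ i → x i ∸ 1) x i₀∉E)) (trans e₀ lowered)))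
                                             (∸-monoʳ-< {minPos x} {1} {0} (s≤s z≤n) pos))
                                  (min≤ x i₀))

    anchored : Pos N → Subset N → Fin N → ℕ → Pos N
    anchored x E i₀ v = upd i₀ v (subχ x E)

    anchored-option : ∀ {x E i₀ v} → i₀ ∈ E → v < x i₀ → Playable x E → Option x E (anchored x E i₀ v)
    anchored-option {x} {E} {i₀} {v} i₀∈E v<xi₀ playable = lt , eq
      where
      lt : ∀ l → l ∈ E → anchored x E i₀ v l < x l
      lt l l∈E with upd-view i₀ v (subχ x E) l
      ... | inj₁ (refl , e) rewrite e = v<xi₀
      ... | inj₂ (_ , e) rewrite e | sel-in E (λ i → x i ∸ 1) x l∈E = ∸-monoʳ-< {x l} {1} {0} (s≤s z≤n) (playable l l∈E)
      eq : ∀ l → l ∉ E → anchored x E i₀ v l ≡ x l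
      eq l l∉E with upd-view i₀ v (subχ x E) l
      ... | inj₁ (refl , _) = ⊥-elim (l∉E i₀∈E)
      ... | inj₂ (_ , e) = trans e (sel-out E (λ i → x i ∸ 1) x l∉E)

    -- Raising the anchor coordinate from v back to m − 1 costs at most
    -- m − 1 − v moves, so the anchored option keeps height ≥ h x − (m − v).
    anchored-height : ∀ {x E i₀ v m} j → h (subχ x E) ≡ h x ∸ 1 → i₀ ∈ E → x i₀ ≡ m → v < m →
                      j + (m ∸ v) ≤ h x → j ≤ h (anchored x E i₀ v)
    anchored-height {x} {E} {i₀} {v} j drop i₀∈E xi₀ v<m tall with m≤n⇒∃[o]m+o≡n v<m
    ... | o , refl = +-cancelʳ-≤ o j _ (begin
      j + o                         ≤⟨ m+n≤o⇒m≤o∸n (j + o) (subst (_≤ h x) (+-comm 1 (j + o)) tall') ⟩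
      h x ∸ 1                       ≡⟨ sym drop ⟩
      h (subχ x E)                  ≤⟨ h-upd o i₀ v (subχ x E) (trans (sel-in E (λ i → x i ∸ 1) x i₀∈E) (cong (_∸ 1) xi₀)) ⟩
      h (anchored x E i₀ v) + o     ∎)
      where
      open ≤-Reasoning
      tall' : suc (j + o) ≤ h x
      tall' = subst (_≤ h x) (trans (cong (j +_) gap) (+-suc j o)) tall
        where
        gap : suc v + o ∸ v ≡ suc o
        gap = trans (cong (_∸ v) (sym (+-suc v o))) (m+n∸m≡n v (suc o))

    subk-below-anchored : ∀ {x E i₀ m} k → i₀ ∈ E → x i₀ ≡ m → 1 ≤ k → subk E k x ≤ₚ anchored x E i₀ (m ∸ k)
    subk-below-anchored {x} {E} {i₀} {m} k i₀∈E xi₀ 1≤k l with upd-view i₀ (m ∸ k) (subχ x E) l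
    ... | inj₁ (refl , e) rewrite e | sel-in E (λ l → x l ∸ k) x i₀∈E = ≤-reflexive (cong (_∸ k) xi₀)
    ... | inj₂ (_ , e) rewrite e = sel-mono E {b = x} {b' = x} (λ l → ∸-monoʳ-≤ (x l) 1≤k) (λ _ → ≤-refl) l

    -- A playable hyperedge with a face option of height ≥ j: the first move
    -- of a longest play when m(u) = 0, the anchored (D2)-option otherwise.
    top-edge : ∀ u j → j + minPos u ≤ h u → j < h u → ∃ λ E → ℋ E × Playable u E × FaceOption u E j
    top-edge u j tall j<h with minPos u ≟ 0
    ... | yes m≡0 = first-move (h u) (longest u) j<h
      where
      first-move : ∀ K → Play ℋ u K → j < K → ∃ λ E → ℋ E × Playable u E × FaceOption u E j
      first-move (suc k) (step {x' = x'} mv@(E , hE , lt , eq) rest) (s≤s j≤k) =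
        E , hE , (λ i i∈E → ≤-trans (s≤s z≤n) (lt i i∈E)) , x' , (lt , eq) , face , ≤-trans j≤k (h-max x' k rest)
        where
        face : minPos x' ≡ 0
        face with min-attained u
        ... | i₀ , e₀ = n≤0⇒n≡0 (≤-trans (min≤ x' i₀) (≤-trans (move-≤ mv i₀) (≤-reflexive (trans e₀ m≡0))))
    ... | no m≢0 with anchor u (n≢0⇒n>0 m≢0)
    ...   | E , hE , drop , i₀ , i₀∈E , ui₀ =
      E , hE , playable , anchored u E i₀ 0 , anchored-option i₀∈E (subst (0 <_) (sym ui₀) pos) playable ,
      min-zero _ i₀ (upd-same i₀ 0 _) , anchored-height j drop i₀∈E ui₀ pos tall
      where
      pos : 0 < minPos u
      pos = n≢0⇒n>0 m≢0
      playable : Playable u E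
      playable l _ = ≤-trans pos (min≤ u l)

    Bottom : Pos N → Set
    Bottom u = ∃ λ E → ℋ E × Playable u E × h (zeroOn E u) ≤ minPos u

    restricted-transversal : ∀ S → S ⊂ ⊤ → (∃ λ E → Restrict ℋ S E) →
                             ¬¬ (∃ λ E → Restrict ℋ S E × Transversal (Restrict ℋ S) E)
    restricted-transversal S S⊂⊤ nonempty none = proj₂ minimal S S⊂⊤ nonempty (λ E hE tr → none (E , hE , tr))

    -- If p vanishes on Z and every hyperedge that avoids i₀ and is playable
    -- at p meets Z, then every move from below p uses i₀, so h p ≤ p i₀.
    h-through : ∀ (Z : Subset N) i₀ p → (∀ l → l ∈ Z → p l ≡ 0) →
                (∀ E → ℋ E → i₀ ∉ E → Playable p E → ∃ λ l → l ∈ Z ∩ E) → h p ≤ p i₀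
    h-through Z i₀ p zero-on meets = bound p (h p) (longest p) (λ _ → ≤-refl)
      where
      bound : ∀ q k → Play ℋ q k → q ≤ₚ p → k ≤ q i₀
      bound q .0 stop _ = z≤n
      bound q (suc k) (step {x' = x'} mv@(E , hE , lt , _) rest) q≤p with i₀ ∈? E
      ... | yes i₀∈E = ≤-<-trans (bound x' k rest (λ l → ≤-trans (move-≤ mv l) (q≤p l))) (lt i₀ i₀∈E)
      ... | no i₀∉E with meets E hE i₀∉E (λ l l∈E → ≤-trans (s≤s z≤n) (<-≤-trans (lt l l∈E) (q≤p l)))
      ...   | l , l∈Z∩E = ⊥-elim (<⇒≱ (<-≤-trans (lt l (proj₂ (x∈p∩q⁻ Z E l∈Z∩E))) (q≤p l))
                                      (≤-trans (≤-reflexive (zero-on l (proj₁ (x∈p∩q⁻ Z E l∈Z∩E)))) z≤n))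

    bottom-from : ∀ u i₀ S → u i₀ ≡ minPos u → i₀ ∉ S → (∃ λ E → Restrict ℋ S E) →
                  (∀ E → ℋ E → E ⊆ S → Playable u E) → (∀ E → ℋ E → i₀ ∉ E → Playable u E → E ⊆ S) → ¬¬ Bottom u
    bottom-from u i₀ S ui₀ i₀∉S nonempty inside-playable playable-inside none =
      restricted-transversal S ((λ _ → ∈⊤) , i₀ , ∈⊤ , i₀∉S) nonempty
        (λ (E , (hE , E⊆S) , tr) → none (E , hE , inside-playable E hE E⊆S , bottom E hE E⊆S tr))
      where
      bottom : ∀ E → ℋ E → E ⊆ S → Transversal (Restrict ℋ S) E → h (zeroOn E u) ≤ minPos u
      bottom E hE E⊆S tr = subst (h (zeroOn E u) ≤_) (trans (sel-out E (λ _ → 0) u (λ i₀∈E → i₀∉S (E⊆S i₀∈E))) ui₀)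
        (h-through E i₀ (zeroOn E u) (λ l l∈E → sel-in E (λ _ → 0) u l∈E)
          (λ E' hE' i₀∉E' playable → tr E' (hE' , playable-inside E' hE' i₀∉E' (λ l l∈E' →
             ≤-trans (playable l l∈E') (sel-case E (λ _ → 0) u l (_≤ u l) (λ _ → z≤n) (λ _ → ≤-refl))))))

    positive : Pos N → Subset N
    positive u = tabulate (λ l → 1 ≤ᵇ u l)

    positive⁺ : ∀ u l → 1 ≤ u l → l ∈ positive u
    positive⁺ u l le = lookup⇒[]= l (positive u) (trans (lookup∘tabulate (λ l → 1 ≤ᵇ u l) l) (Equivalence.to T-≡ (≤⇒≤ᵇ le)))

    positive⁻ : ∀ u l → l ∈ positive u → 1 ≤ u l
    positive⁻ u l l∈ = ≤ᵇ⇒≤ 1 (u l) (Equivalence.from T-≡ (trans (sym (lookup∘tabulate (λ l → 1 ≤ᵇ u l) l)) ([]=⇒lookup l∈)))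

    -- Some bottom edge exists (¬¬): with S the positive coordinates when
    -- m(u) = 0, and with S = V − {i₀} when m(u) > 0.
    bottom-edge : ∀ u → (∃ λ E → ℋ E × Playable u E) → ¬¬ Bottom u
    bottom-edge u (Ea , hEa , playable-a) with min-attained u | minPos u ≟ 0
    ... | i₀ , ui₀ | yes m≡0 =
      bottom-from u i₀ (positive u) ui₀ (λ i₀∈ → <⇒≱ (positive⁻ u i₀ i₀∈) (≤-reflexive (trans ui₀ m≡0)))
        (Ea , hEa , (λ {l} l∈ → positive⁺ u l (playable-a l l∈)))
        (λ E _ E⊆S l l∈E → positive⁻ u l (E⊆S l∈E))
        (λ E _ _ playable {l} l∈E → positive⁺ u l (playable l l∈E))
    ... | i₀ , ui₀ | no m≢0 = λ none → avoiding (λ (Ea' , hEa' , i₀∉Ea') →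
      bottom-from u i₀ (∁ ⁅ i₀ ⁆) ui₀ (x∈p⇒x∉∁p (x∈⁅x⁆ i₀)) (Ea' , hEa' , ⊆-avoid i₀∉Ea')
        (λ _ _ _ l _ → ≤-trans (n≢0⇒n>0 m≢0) (min≤ u l))
        (λ E _ i₀∉E _ → ⊆-avoid i₀∉E) none)
      where
      ⊆-avoid : ∀ {E} → i₀ ∉ E → E ⊆ ∁ ⁅ i₀ ⁆
      ⊆-avoid i₀∉E {l} l∈E = x∉p⇒x∈∁p (x≢y⇒x∉⁅y⁆ (λ l≡i₀ → i₀∉E (subst (_∈ _) l≡i₀ l∈E)))
      -- If every hyperedge contained i₀, the hyperedge E₀ would be a transversal.
      avoiding : ¬¬ (∃ λ E → ℋ E × i₀ ∉ E)
      avoiding none = proj₁ minimal E₀ hE₀ (λ E hE → i₀ , x∈p∩q⁺ (contains E₀ hE₀ , contains E hE))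
        where
        contains : ∀ E → ℋ E → i₀ ∈ E
        contains E hE with i₀ ∈? E
        ... | yes i₀∈E = i₀∈E
        ... | no i₀∉E = ⊥-elim (none (E , hE , i₀∉E))

    -- One link C₀ → C₁ of a chain (sharing the coordinate i, adding at most
    -- one coordinate): if zeroing u on C₀ keeps height > j, then the option
    -- q of C₁ that sets i to 0 is a face option of height ≥ j, because
    -- zeroOn C₀ u lies below q raised by one at the new coordinate.
    chain-step : ∀ {u j C₀ C₁} i → i ∈ C₀ → i ∈ C₁ → ∣ C₁ ─ C₀ ∣ ≤ 1 → Playable u C₁ →
                 j < h (zeroOn C₀ u) → FaceOption u C₁ j
    chain-step {u} {j} {C₀} {C₁} i i∈C₀ i∈C₁ new≤1 playable tall =
      q , opt , min-zero q i (upd-same i 0 _) , ≤-pred (≤-trans tall zeroed≤)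
      where
      q : Pos N
      q = anchored u C₁ i 0
      opt : Option u C₁ q
      opt = anchored-option i∈C₁ (playable i i∈C₁) playable
      q-new : ∀ l → l ∉ C₀ → l ∈ C₁ → q l ≡ u l ∸ 1
      q-new l l∉C₀ l∈C₁ with upd-view i 0 (subχ u C₁) l
      ... | inj₁ (refl , _) = ⊥-elim (l∉C₀ i∈C₀)
      ... | inj₂ (_ , e) = trans e (sel-in C₁ (λ l → u l ∸ 1) u l∈C₁)
      zeroed : ∀ {b} → (∀ l → l ∉ C₀ → l ∈ C₁ → u l ≤ b l) → q ≤ₚ b → zeroOn C₀ u ≤ₚ b
      zeroed {b} new-≤ q≤b l = sel-case C₀ (λ _ → 0) u l (_≤ b l) (λ _ → z≤n) outside
        where
        outside : l ∉ C₀ → u l ≤ b l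
        outside l∉C₀ with l ∈? C₁
        ... | yes l∈C₁ = new-≤ l l∉C₀ l∈C₁
        ... | no l∉C₁ = ≤-trans (≤-reflexive (sym (proj₂ opt l l∉C₁))) (q≤b l)
      zeroed≤ : h (zeroOn C₀ u) ≤ suc (h q)
      zeroed≤ with nonempty? (C₁ ─ C₀)
      ... | no none = ≤-trans (h-mono (zeroed (λ l l∉C₀ l∈C₁ → ⊥-elim (none (l , x∈p∧x∉q⇒x∈p─q l∈C₁ l∉C₀))) (λ _ → ≤-refl)))
                              (n≤1+n _)
      ... | yes (v , v∈new) = ≤-trans (h-mono (zeroed new-≤ (raise-≥ v q))) (h-raise v q)
        where
        new-≤ : ∀ l → l ∉ C₀ → l ∈ C₁ → u l ≤ raise v q l
        new-≤ l l∉C₀ l∈C₁ with size≤1-unique (C₁ ─ C₀) new≤1 (x∈p∧x∉q⇒x∈p─q l∈C₁ l∉C₀) v∈new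
        ... | refl rewrite upd-same l (suc (q l)) q | q-new l l∉C₀ l∈C₁ = m≤n+m∸n (u l) 1

    -- Walking a (D1) chain from Ea to Eb: as long as zeroing the current
    -- hyperedge keeps height > j, the face option moves along the chain;
    -- at Eb, where zeroing drops the height to ≤ j, it yields the move.
    chain-walk : ∀ {u j Ea Eb} → ℋ Ea → ℋ Eb → Playable u Ea → Playable u Eb →
                 FaceOption u Ea j → h (zeroOn Eb u) ≤ j → FaceMove u j
    chain-walk {u} {j} {Ea} {Eb} hEa hEb playable-a playable-b start end with chains Ea Eb hEa hEb
    ... | p , c , inℋ , c₀ , cₚ , links , within = arrive (walk p ≤-refl)
      where
      playable : ∀ k → k ≤ p → Playable u (c k)
      playable zero _ = subst (Playable u) (sym c₀) playable-a
      playable (suc k) le i i∈ with x∈p∪q⁻ Ea Eb (within (suc k) (s≤s z≤n) le i∈)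
      ... | inj₁ i∈Ea = playable-a i i∈Ea
      ... | inj₂ i∈Eb = playable-b i i∈Eb
      walk : ∀ k → k ≤ p → FaceOption u (c k) j ⊎ FaceMove u j
      walk zero _ = inj₁ (subst (λ E → FaceOption u E j) (sym c₀) start)
      walk (suc k) le with walk k (≤-trans (n≤1+n k) le)
      ... | inj₂ done = inj₂ done
      ... | inj₁ opt with h (zeroOn (c k) u) ≤? j
      ...   | yes low = inj₂ (face-move (inℋ k (≤-trans (n≤1+n k) le)) opt low)
      ...   | no high with links k le
      ...     | (i , i∈∩) , new≤1 = inj₁ (chain-step i (proj₂ (x∈p∩q⁻ (c (suc k)) (c k) i∈∩))
                                           (proj₁ (x∈p∩q⁻ (c (suc k)) (c k) i∈∩)) new≤1 (playable (suc k) le) (≰⇒> high))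
      arrive : FaceOption u (c p) j ⊎ FaceMove u j → FaceMove u j
      arrive (inj₂ done) = done
      arrive (inj₁ opt) = face-move hEb (subst (λ E → FaceOption u E j) cₚ opt) end

    -- Reaching height j on the face m = 0: join a top edge to a bottom edge.
    reach-face : ∀ u j → minPos u ≤ j → j + minPos u ≤ h u → j < h u → ¬¬ FaceMove u j
    reach-face u j m≤j tall j<h none with top-edge u j tall j<h
    ... | Ea , hEa , playable-a , start =
      bottom-edge u (Ea , hEa , playable-a)
        (λ (Eb , hEb , playable-b , low) → none (chain-walk hEa hEb playable-a playable-b start (≤-trans low m≤j)))

    -- Moves with prescribed new minimum m − d and level t': reach height t'
    -- on the face of u = x − (m − d)e, then shift back up by m − d.
    reach-shape : ∀ x d t' → d ≤ t' → t' ≤ level x → t' < level x + d → d ≤ minPos x →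
                  ¬¬ (∃ λ x' → Move ℋ x x' × minPos x' ≡ minPos x ∸ d × level x' ≡ t')
    reach-shape x d t' d≤t' t'≤t t'<t+d d≤m none with min-attained x
    ... | i₀ , xi₀ = reach-face u t' (≤-trans (≤-reflexive mu) d≤t')
                       (≤-trans (≤-reflexive (cong (t' +_) mu)) (≤-trans (+-monoˡ-≤ d t'≤t) tall))
                       (<-≤-trans t'<t+d tall) (λ (w , mv , mw , hw) → none (lift w mv mw hw))
      where
      m : ℕ
      m = minPos x
      u : Pos N
      u i = subMin x i + d
      mu : minPos u ≡ d
      mu = min-char u d i₀ (λ j → m≤n+m d _) (cong (_+ d) (trans (cong (_∸ m) xi₀) (n∸n≡0 m)))
      tall : level x + d ≤ h u
      tall = begin
        level x + d                      ≡⟨ +-comm _ d ⟩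
        d + h (subMin x)                 ≡⟨ cong (d +_) (h-resp (λ i → sym (m+n∸n≡m (subMin x i) d))) ⟩
        d + h (λ i → u i ∸ d)            ≤⟨ h-shift E₀ hE₀ u d (λ j → m≤n+m d _) ⟩
        h u                              ∎
        where open ≤-Reasoning
      lift : ∀ w → Move ℋ u w → minPos w ≡ 0 → h w ≡ t' →
             ∃ λ x' → Move ℋ x x' × minPos x' ≡ m ∸ d × level x' ≡ t'
      lift w mv mw hw = x' , move-resp back (move-shift mv (m ∸ d)) , mx' , trans (h-resp unshift) hw
        where
        x' : Pos N
        x' i = w i + (m ∸ d)
        back : (λ i → u i + (m ∸ d)) ≗ₚ x
        back i = trans (+-assoc (subMin x i) d (m ∸ d)) (trans (cong (subMin x i +_) (m+[n∸m]≡n d≤m)) (m∸n+n≡m (min≤ x i)))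
        mx' : minPos x' ≡ m ∸ d
        mx' with min-attained w
        ... | i₁ , wi₁ = min-char x' (m ∸ d) i₁ (λ j → m≤n+m _ (w j)) (cong (_+ (m ∸ d)) (trans wi₁ mw))
        unshift : subMin x' ≗ₚ w
        unshift i = trans (cong (x' i ∸_) mx') (m+n∸n≡m (w i) (m ∸ d))

    -- Low regime with h x ≤ j + m(x): with k = h x − j, an E-move into the
    -- box between x − kχ(E) (height ≤ j) and the anchored option setting
    -- the minimal coordinate to m − k (height ≥ j) has height j, minimum
    -- m − k and level ≥ t(x), so it stays in the low regime.
    reach-low-tall : ∀ x j → 1 ≤ minPos x → minPos x ≤ cut x → j < h x → h x ≤ j + minPos x →
                     ∃ λ w → Move ℋ x w × f w ≡ j
    reach-low-tall x j pos low j<h short with anchor x pos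
    ... | E , hE , drop , i₀ , i₀∈E , xi₀ =
      finish (move-to-height B j hE opt (subk-below-anchored k i₀∈E xi₀ 1≤k) (λ l l∉E → sel-out E (λ l → x l ∸ k) x l∉E) hB jP)
      where
      m : ℕ
      m = minPos x
      k : ℕ
      k = h x ∸ j
      hk : h x ≡ j + k
      hk = sym (m+[n∸m]≡n (<⇒≤ j<h))
      1≤k : 1 ≤ k
      1≤k = m<n⇒0<n∸m j<h
      k≤m : k ≤ m
      k≤m = m≤n+o⇒m∸n≤o (h x) j short
      m∸k<m : m ∸ k < m
      m∸k<m = ∸-monoʳ-< {m} {k} {0} 1≤k k≤m
      B : Pos N
      B = subk E k x
      P : Pos N
      P = anchored x E i₀ (m ∸ k)
      opt : Option x E P
      opt = anchored-option i₀∈E (subst (m ∸ k <_) (sym xi₀) m∸k<m) (λ l _ → ≤-trans pos (min≤ x l))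
      jP : j ≤ h P
      jP = anchored-height j drop i₀∈E xi₀ m∸k<m (≤-reflexive (trans (cong (j +_) (m∸[m∸n]≡n k≤m)) (sym hk)))
      hB : h B ≤ j
      hB = +-cancelˡ-≤ k (h B) j (≤-trans (h-subk E hE k x (λ l _ → ≤-trans k≤m (min≤ x l)))
                                          (≤-reflexive (trans hk (+-comm j k))))
      finish : (∃ λ w → Move ℋ x w × B ≤ₚ w × w ≤ₚ P × h w ≡ j) → ∃ λ w → Move ℋ x w × f w ≡ j
      finish (w , mv , B≤w , w≤P , hw) = w , mv , trans (f-low w (low-preserved x w k above mw k≤m low)) hw
        where
        above : ∀ l → x l ∸ k ≤ w l
        above l = ≤-trans (sel-case E (λ l → x l ∸ k) x l (x l ∸ k ≤_) (λ _ → ≤-refl) (λ _ → m∸n≤m (x l) k)) (B≤w l)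
        mw : minPos w ≡ m ∸ k
        mw = min-lowered x w k i₀ xi₀ above (≤-trans (w≤P i₀) (≤-reflexive (upd-same i₀ (m ∸ k) (subχ x E))))

    Reaches : Pos N → ℕ → Set
    Reaches x j = ∃ λ x' → Move ℋ x x' × f x' ≡ j

    -- j below m(x) and c(x): j lies in the block of some t' < t(x); move to
    -- level t' with the minimum lowered so that the residue of m − d is j.
    reach-block : ∀ x j → j < minPos x → j < cut x → ¬¬ Reaches x j
    reach-block x j j<m j<c with block-exists j
    ... | t' , lo , hi with m≤n⇒∃[o]m+o≡n lo
    ...   | r' , refl with residue-hit-below {minPos x} {suc t' C 2} {r'} {t'}
                             (+-cancelˡ-< (suc t' C 2) r' (suc t') hi) j<m refl
    ...     | d≤t' , d≤m , j<m-d , value = λ none → reach-shape x d t' d≤t' (<⇒≤ t'<t) (≤-trans t'<t (m≤m+n _ d)) d≤m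
                (λ (x' , mv , mx' , tx') → none (x' , mv , trans (f-shape x' mx' tx' (≤-<-trans (m≤m+n _ r') j<m-d)) value))
      where
      d : ℕ
      d = (minPos x ∸ (suc t' C 2 + r') ∸ 1) % suc t'
      t'<t : t' < level x
      t'<t = ≰⇒> (λ t≤t' → <⇒≱ j<c (≤-trans (C-mono (s≤s t≤t')) (m≤m+n _ r')))

    -- j in the residue range [c(x), f(x)): keep the level and lower the
    -- minimum by f(x) − j.
    reach-residue : ∀ x j → cut x < minPos x → cut x ≤ j → j < f x → ¬¬ Reaches x j
    reach-residue x j high c≤j j<f with residue-hit-above {minPos x} {cut x} {j} {level x} high c≤j (subst (j <_) (f-high x high) j<f)
    ... | d≤t , 1≤d , d≤m , high' , value = λ none →
      reach-shape x d (level x) d≤t ≤-refl (subst (_< level x + d) (+-identityʳ _) (+-monoʳ-< (level x) 1≤d)) d≤m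
        (λ (x' , mv , mx' , tx') → none (x' , mv , trans (f-shape x' mx' tx' high') value))
      where
      d : ℕ
      d = Residue (cut x) (level x) (minPos x) ∸ j

    f-reaches : ∀ x j → j < f x → ¬¬ Reaches x j
    f-reaches x j j<f with minPos x ≤? cut x
    ... | no high with j <? cut x
    ...   | yes j<c = reach-block x j (<-trans j<c (≰⇒> high)) j<c
    ...   | no j≮c = reach-residue x j (≰⇒> high) (≮⇒≥ j≮c) j<f
    f-reaches x j j<f | yes low with j <? minPos x | j + minPos x ≤? h x
    ... | yes j<m | _ = reach-block x j j<m (<-≤-trans j<m low)
    ... | no j≮m | yes tall = λ none → reach-face x j (≮⇒≥ j≮m) tall j<h
                                 (λ (w , mv , mw , hw) → none (w , mv , trans (f-low w (≤-trans (≤-reflexive mw) z≤n)) hw))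
      where
      j<h : j < h x
      j<h = subst (j <_) (f-low x low) j<f
    ... | no j≮m | no short = λ none → none (reach-low-tall x j pos low j<h (<⇒≤ (≰⇒> short)))
      where
      j<h : j < h x
      j<h = subst (j <_) (f-low x low) j<f
      pos : 1 ≤ minPos x
      pos = ≰⇒> (λ m≤0 → short (≤-trans (+-monoʳ-≤ j m≤0) (≤-trans (≤-reflexive (+-identityʳ j)) (<⇒≤ j<h))))

theorem4p4 : ∀ (n : ℕ) (ℋ : Family n) → IsHypergraph ℋ →
    MinimalTransversalFree ℋ → D1 ℋ → D2 ℋ → JM ℋ
theorem4p4 zero ℋ (([] , ℋ∅) , ∅∉ℋ , _) = ⊥-elim (∅∉ℋ ℋ∅)
theorem4p4 (suc n') ℋ ((E₀ , hE₀) , _ , _) minimal chains descents h g isHeight isSG =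
  sg-unique (fJM h) g isSG f-separated f-reaches
  where
  open Height ℋ h isHeight using (sg-unique)
  open Grundy ℋ h isHeight using (module Separation; module Reach)
  open Separation E₀ hE₀ (proj₁ minimal) using (f-separated)
  open Reach E₀ hE₀ minimal chains descents using (f-reaches)
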